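{- Define the integer sequence $(b_n)_{n\ge1}$ by $b_1=6$ and $b_n=4b_{n-1}-2$ for $n>1$. Let $\mathcal{B}(m)$ be the number of factors of length $m$ of the Thue–Morse word $t$ that are both privileged and palindromes. Then $\mathcal{B}(b_n)=4$ for all $n\ge1$.
   Context: The Thue–Morse word $t$ is the fixed point beginning with $0$ of the morphism $0\mapsto01,\ 1\mapsto10$. A palindrome is a word equal to its reversal. A complete first return to a word $v$ is a word that begins with $v$, ends with $v$, and contains exactly two occurrences of $v$. Privileged words: the empty word and every letter are privileged, and a word is privileged if it is a complete first return to a shorter privileged word. -}

module Defs where

open import Data.Bool using (Bool; true; false; not; _∧_; if_then_else_)
open import Data.Bool.Properties using () renaming (_≟_ to _≟B_)
open import Data.Nat using (ℕ; zero; suc; _+_; _*_; _∸_; _<_)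
open import Data.List using (List; []; _∷_; _++_; length; map; concatMap; reverse; upTo)
open import Data.List.Relation.Unary.Unique.Propositional using (Unique)
open import Data.List.Membership.Propositional using (_∈_)
open import Data.Product using (_×_; ∃; Σ)
open import Relation.Binary.PropositionalEquality using (_≡_)
open import Relation.Nullary.Decidable using (⌊_⌋)
open import Function.Bundles using (_⇔_)

-- Words over the binary alphabet {0,1}, with 0 = false and 1 = true.
Word : Set
Word = List Bool

μ : Word → Word
μ = concatMap (λ a → a ∷ not a ∷ [])

μ^ : ℕ → Word → Word
μ^ zero w = w
μ^ (suc k) w = μ (μ^ k w)

-- letter at position i (default value for out-of-range positions)
nth : Word → ℕ → Bool
nth [] _ = false
nth (x ∷ xs) zero = x
nth (x ∷ xs) (suc i) = nth xs i

-- The Thue–Morse word t (fixed point of μ starting with 0):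
-- t i is the i-th letter (0-indexed) of μ^(i+1)(0), a prefix of t of length 2^(i+1) > i.
t : ℕ → Bool
t i = nth (μ^ (suc i) (false ∷ [])) i

factorAt : ℕ → ℕ → Word
factorAt i m = map (λ k → t (i + k)) (upTo m)

IsFactorOfLength : ℕ → Word → Set
IsFactorOfLength m w = ∃ λ i → factorAt i m ≡ w

Palindrome : Word → Set
Palindrome w = reverse w ≡ w

isPrefixB : Word → Word → Bool
isPrefixB [] _ = true
isPrefixB (x ∷ xs) [] = false
isPrefixB (x ∷ xs) (y ∷ ys) = ⌊ x ≟B y ⌋ ∧ isPrefixB xs ys

occ : Word → Word → ℕ
occ v [] = if isPrefixB v [] then 1 else 0
occ v (x ∷ xs) = (if isPrefixB v (x ∷ xs) then 1 else 0) + occ v xs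

CompleteFirstReturn : Word → Word → Set
CompleteFirstReturn v w =
  (∃ λ u → v ++ u ≡ w) × (∃ λ u → u ++ v ≡ w) × occ v w ≡ 2

data Privileged : Word → Set where
  priv-empty  : Privileged []
  priv-letter : (a : Bool) → Privileged (a ∷ [])
  priv-return : ∀ {v w} → length v < length w → Privileged v →
                CompleteFirstReturn v w → Privileged w

𝓑≡ : ℕ → ℕ → Set
𝓑≡ m k = Σ (List Word) λ L → Unique L × length L ≡ k ×
  ((w : Word) → (w ∈ L) ⇔ (IsFactorOfLength m w × Privileged w × Palindrome w))

-- b_1 = 6, b_n = 4 b_{n-1} - 2 (n > 1); b 0 is an unused dummy value.
b : ℕ → ℕ
b zero = 0
b (suc zero) = 6
b (suc (suc n)) = 4 * b (suc n) ∸ 2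

-- Let φ(w) be μ²(w) with its first and last letters removed. Since t(2n) = t(n) and
-- t(2n+1) = ¬t(n), φ maps the factor of t of length m+1 at position k to the factor of
-- length 4m+2 at position 4k+1. Conversely, let p be a palindromic factor of t of length
-- 8g+22 at position i. Its two central letters coincide, and equal adjacent letters of t
-- start at odd positions, so i is odd; if i ≡ 3 (mod 4), reading p through
-- t(4n) = t(4n+3) = t(n) yields a palindrome of length 5, which t does not contain. Hence
-- i ≡ 1 (mod 4) and p is the φ-image of a palindromic factor of length 2g+6. As b₁ = 6 and
-- bₙ₊₁ = 4bₙ − 2, the palindromic factors of length bₙ are the φⁿ⁻¹-images of 101101,
-- 010010, 110011 and 001100.
--
-- The same desubstitution shows that the occurrences of φ(v) in φ(u) are exactly the
-- occurrences of v in u, at four times the position, so φ maps complete first returns between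
-- such factors to complete first returns. Privilege then propagates along complete first
-- returns: φ(001100) is one to 110011, φ(110011) to 001100, φ(0010110100) to 110011 and
-- φ(101101) to 0010110100, and likewise with 0 and 1 exchanged.

module Submission where

open import Defs
open import Data.Bool using (Bool; true; false; not)
open import Data.Bool.Properties using (not-involutive; not-injective; not-¬; ¬-not) renaming (_≟_ to _≟B_)
open import Data.Empty using (⊥; ⊥-elim)
open import Data.List using (List; []; _∷_; _++_; length; map; reverse; drop; take; applyUpTo)
open import Data.List.Properties
  using (map-applyUpTo; unfold-reverse; reverse-++; reverse-involutive; length-reverse; length-++; length-drop;
         drop-drop; take++drop≡id; ++-identityʳ)
open import Data.List.Membership.Propositional using (_∈_)
open import Data.List.Membership.Propositional.Properties using (∈-map⁺)
import Data.List.Relation.Unary.All as All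
import Data.List.Relation.Unary.AllPairs as AllPairs
open import Data.List.Relation.Unary.Any using (here; there)
open import Data.List.Relation.Unary.Unique.Propositional using (Unique)
open import Data.List.Relation.Unary.Unique.Propositional.Properties using (map⁺)
open import Data.Nat using (ℕ; zero; suc; _+_; _*_; _∸_; _≤_; _<_; z≤n; s≤s; _≤?_)
open import Data.Nat.Properties
open import Data.Nat.Tactic.RingSolver using (solve)
open import Data.Product using (_×_; ∃; _,_)
open import Data.Sum using (_⊎_; inj₁; inj₂)
open import Function.Bundles using (mk⇔)
open import Relation.Binary.Definitions using (tri<; tri≈; tri>)
open import Relation.Binary.PropositionalEquality
open import Relation.Nullary using (¬_; yes; no)
import Relation.Binary.Construct.On as On
import Relation.Binary.Reasoning.Setoid as SetoidReasoning

-- Letters of t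

prefix : ℕ → Word
prefix k = μ^ k (false ∷ [])

μ-++ : ∀ xs ys → μ (xs ++ ys) ≡ μ xs ++ μ ys
μ-++ []       ys = refl
μ-++ (x ∷ xs) ys = cong (λ w → x ∷ not x ∷ w) (μ-++ xs ys)

length-μ : ∀ w → length (μ w) ≡ length w + length w
length-μ []      = refl
length-μ (a ∷ w) = cong suc (trans (cong suc (length-μ w)) (sym (+-suc (length w) (length w))))

nth-++ˡ : ∀ xs ys {i} → i < length xs → nth (xs ++ ys) i ≡ nth xs i
nth-++ˡ (x ∷ xs) ys {zero}  _         = refl
nth-++ˡ (x ∷ xs) ys {suc i} (s≤s i<n) = nth-++ˡ xs ys i<n

nth-μ-double : ∀ w {x} → x < length w → nth (μ w) (x + x) ≡ nth w x
nth-μ-double (a ∷ w) {zero}  _         = refl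
nth-μ-double (a ∷ w) {suc x} (s≤s x<n) rewrite +-suc x x = nth-μ-double w x<n

nth-μ-double-suc : ∀ w {x} → x < length w → nth (μ w) (suc (x + x)) ≡ not (nth w x)
nth-μ-double-suc (a ∷ w) {zero}  _         = refl
nth-μ-double-suc (a ∷ w) {suc x} (s≤s x<n) rewrite +-suc x x = nth-μ-double-suc w x<n

prefix-⊑ : ∀ {k k′} → k ≤ k′ → ∃ λ s → prefix k ++ s ≡ prefix k′
prefix-⊑ {k′ = k′} z≤n = starts-with-0 k′
  where
  starts-with-0 : ∀ k → ∃ λ s → false ∷ s ≡ prefix k
  starts-with-0 zero    = [] , refl
  starts-with-0 (suc k) with starts-with-0 k
  ... | s , e = true ∷ μ s , cong μ e
prefix-⊑ {suc k} (s≤s k≤k′) with prefix-⊑ k≤k′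
... | s , e = μ s , trans (sym (μ-++ (prefix k) s)) (cong μ e)

suc-double-< : ∀ {x n} → x < n → suc (x + x) < n + n
suc-double-< {x} {n} x<n = subst (_≤ n + n) (cong suc (+-suc x x)) (+-mono-≤ x<n x<n)

<-length-prefix : ∀ i → i < length (prefix i)
<-length-prefix zero    = s≤s z≤n
<-length-prefix (suc i) = subst (suc i <_) (sym (length-μ (prefix i)))
  (≤-trans (s≤s (s≤s (m≤m+n i i))) (suc-double-< (<-length-prefix i)))

nth-⊑ : ∀ {xs ys i} → (∃ λ s → xs ++ s ≡ ys) → i < length xs → nth xs i ≡ nth ys i
nth-⊑ {xs} (s , refl) i<n = sym (nth-++ˡ xs s i<n)

nth-prefix : ∀ k {i} → i < length (prefix k) → nth (prefix k) i ≡ t i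
nth-prefix k {i} i<n with ≤-total k (suc i)
... | inj₁ k≤ = nth-⊑ (prefix-⊑ k≤) i<n
... | inj₂ ≤k = sym (nth-⊑ (prefix-⊑ ≤k) (<-trans (n<1+n i) (<-length-prefix (suc i))))

t-double : ∀ x → t (x + x) ≡ t x
t-double x = begin
  t (x + x)                  ≡⟨ nth-prefix (suc x) x+x< ⟨
  nth (μ (prefix x)) (x + x) ≡⟨ nth-μ-double (prefix x) x< ⟩
  nth (prefix x) x           ≡⟨ nth-prefix x x< ⟩
  t x                        ∎
  where
  open ≡-Reasoning
  x< = <-length-prefix x
  x+x< : x + x < length (μ (prefix x))
  x+x< = subst (x + x <_) (sym (length-μ (prefix x))) (<⇒≤ (suc-double-< x<))

t-double-suc : ∀ x → t (suc (x + x)) ≡ not (t x)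
t-double-suc x = begin
  t (suc (x + x))                  ≡⟨ nth-prefix (suc x) x+x< ⟨
  nth (μ (prefix x)) (suc (x + x)) ≡⟨ nth-μ-double-suc (prefix x) x< ⟩
  not (nth (prefix x) x)           ≡⟨ cong not (nth-prefix x x<) ⟩
  not (t x)                        ∎
  where
  open ≡-Reasoning
  x< = <-length-prefix x
  x+x< : suc (x + x) < length (μ (prefix x))
  x+x< = subst (suc (x + x) <_) (sym (length-μ (prefix x))) (suc-double-< x<)

t-double-at : ∀ m x → m ≡ x + x → t m ≡ t x
t-double-at _ x refl = t-double x

t-double-suc-at : ∀ m x → m ≡ suc (x + x) → t m ≡ not (t x)
t-double-suc-at _ x refl = t-double-suc x

t-4n : ∀ n → t (4 * n) ≡ t n
t-4n n = trans (t-double-at (4 * n) (n + n) (solve (n ∷ []))) (t-double n)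

t-4n+3 : ∀ n → t (3 + 4 * n) ≡ t n
t-4n+3 n = begin
  t (3 + 4 * n)         ≡⟨ t-double-suc-at (3 + 4 * n) (suc (n + n)) (solve (n ∷ [])) ⟩
  not (t (suc (n + n))) ≡⟨ cong not (t-double-suc n) ⟩
  not (not (t n))       ≡⟨ not-involutive (t n) ⟩
  t n                   ∎
  where open ≡-Reasoning

-- Reasoning on positions of t up to equality of letters: a step m ≈⟨ p ⟩ n needs p : t m ≡ t n,
-- and steps m ≡⟨ p ⟩ n between positions can be discharged by the ring solver.
module SameLetter = SetoidReasoning (On.setoid (setoid Bool) t)

parity : ∀ n → ∃ λ x → n ≡ x + x ⊎ n ≡ suc (x + x)
parity zero = 0 , inj₁ refl
parity (suc n) with parity n
... | x , inj₁ refl = x , inj₂ refl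
... | x , inj₂ refl = suc x , inj₁ (cong suc (sym (+-suc x x)))

x+x≢1+y+y : ∀ x y → x + x ≢ suc (y + y)
x+x≢1+y+y x y e = even≢odd x y
  (trans (cong (x +_) (+-identityʳ x)) (trans e (cong (λ n → suc (y + n)) (sym (+-identityʳ y)))))

square-at-odd : ∀ n → t n ≡ t (suc n) → ∃ λ x → n ≡ suc (x + x)
square-at-odd n same with parity n
... | x , inj₂ odd  = x , odd
... | x , inj₁ refl = ⊥-elim (not-¬ refl (trans (sym (t-double x)) (trans same (t-double-suc x))))

no-letter-cube : ∀ x → t x ≡ t (1 + x) → t (1 + x) ≡ t (2 + x) → ⊥
no-letter-cube x e₁ e₂ with square-at-odd x e₁ | square-at-odd (1 + x) e₂
... | y , x-odd | z , 1+x-odd = x+x≢1+y+y z y (suc-injective (trans (sym 1+x-odd) (cong suc x-odd)))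

no-palindrome₅ : ∀ z → t z ≡ t (4 + z) → t (1 + z) ≡ t (3 + z) → ⊥
no-palindrome₅ z outer inner with parity z
... | u , inj₁ refl = no-letter-cube u u≡1+u (trans (sym u≡1+u) u≡2+u)
  where
  u≡1+u : t u ≡ t (1 + u)
  u≡1+u = not-injective (trans (sym (t-double-suc u))
    (trans inner (t-double-suc-at (3 + (u + u)) (1 + u) (solve (u ∷ [])))))
  u≡2+u : t u ≡ t (2 + u)
  u≡2+u = trans (sym (t-double u)) (trans outer (t-double-at (4 + (u + u)) (2 + u) (solve (u ∷ []))))
... | u , inj₂ refl = no-letter-cube u (trans u≡2+u (sym 1+u≡2+u)) 1+u≡2+u
  where
  u≡2+u : t u ≡ t (2 + u)
  u≡2+u = not-injective (trans (sym (t-double-suc u))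
    (trans outer (t-double-suc-at (4 + suc (u + u)) (2 + u) (solve (u ∷ [])))))
  1+u≡2+u : t (1 + u) ≡ t (2 + u)
  1+u≡2+u = trans (sym (t-double-at (1 + suc (u + u)) (1 + u) (solve (u ∷ []))))
    (trans inner (t-double-at (3 + suc (u + u)) (2 + u) (solve (u ∷ []))))

-- Factors and palindromes of t

factor : ℕ → ℕ → Word
factor i zero    = []
factor i (suc m) = t i ∷ factor (suc i) m

applyUpTo≡factor : ∀ (f : ℕ → Bool) i m → (∀ k → f k ≡ t (k + i)) → applyUpTo f m ≡ factor i m
applyUpTo≡factor f i zero    _    = refl
applyUpTo≡factor f i (suc m) f≡t =
  cong₂ _∷_ (f≡t 0) (applyUpTo≡factor (λ k → f (suc k)) (suc i) m
    (λ k → trans (f≡t (suc k)) (cong t (sym (+-suc k i)))))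

factorAt≡factor : ∀ i m → factorAt i m ≡ factor i m
factorAt≡factor i m = trans (map-applyUpTo (λ k → k) (λ k → t (i + k)) m)
  (applyUpTo≡factor (λ k → t (i + k)) i m (λ k → cong t (+-comm i k)))

length-factor : ∀ i m → length (factor i m) ≡ m
length-factor i zero    = refl
length-factor i (suc m) = cong suc (length-factor (suc i) m)

factor-++ : ∀ i m n → factor i (m + n) ≡ factor i m ++ factor (m + i) n
factor-++ i zero    n = refl
factor-++ i (suc m) n = cong (t i ∷_)
  (trans (factor-++ (suc i) m n) (cong (λ j → factor (suc i) m ++ factor j n) (+-suc m i)))

drop-factor : ∀ q i m → drop q (factor i m) ≡ factor (q + i) (m ∸ q)
drop-factor zero    i m       = refl
drop-factor (suc q) i zero    = refl
drop-factor (suc q) i (suc m) = trans (drop-factor q (suc i) m) (cong (λ j → factor j (m ∸ q)) (+-suc q i))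

nth-factor : ∀ i {m x} → x < m → nth (factor i m) x ≡ t (x + i)
nth-factor i {suc m} {zero}  _         = refl
nth-factor i {suc m} {suc x} (s≤s x<m) = trans (nth-factor (suc i) x<m) (cong t (+-suc x i))

nth-++-length : ∀ xs {a} ys → nth (xs ++ a ∷ ys) (length xs) ≡ a
nth-++-length []       ys = refl
nth-++-length (x ∷ xs) ys = nth-++-length xs ys

nth-reverse : ∀ w {x y} → suc (x + y) ≡ length w → nth (reverse w) x ≡ nth w y
nth-reverse (a ∷ w) {x} {zero} e = begin
  nth (reverse (a ∷ w)) x                         ≡⟨ cong (λ v → nth v x) (unfold-reverse a w) ⟩
  nth (reverse w ++ a ∷ []) x                     ≡⟨ cong (nth (reverse w ++ a ∷ [])) x≡ ⟩
  nth (reverse w ++ a ∷ []) (length (reverse w))  ≡⟨ nth-++-length (reverse w) [] ⟩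
  a                                               ∎
  where
  open ≡-Reasoning
  x≡ : x ≡ length (reverse w)
  x≡ = trans (sym (+-identityʳ x)) (trans (suc-injective e) (sym (length-reverse w)))
nth-reverse (a ∷ w) {x} {suc y} e = begin
  nth (reverse (a ∷ w)) x      ≡⟨ cong (λ v → nth v x) (unfold-reverse a w) ⟩
  nth (reverse w ++ a ∷ []) x  ≡⟨ nth-++ˡ (reverse w) (a ∷ []) x< ⟩
  nth (reverse w) x            ≡⟨ nth-reverse w e′ ⟩
  nth w y                      ∎
  where
  open ≡-Reasoning
  e′ : suc (x + y) ≡ length w
  e′ = trans (sym (+-suc x y)) (suc-injective e)
  x< : x < length (reverse w)
  x< = subst (x <_) (trans e′ (sym (length-reverse w))) (s≤s (m≤m+n x y))

PalindromeAt : ℕ → ℕ → Set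
PalindromeAt i m = ∀ x y → suc (x + y) ≡ m → t (x + i) ≡ t (y + i)

Palindrome⇒PalindromeAt : ∀ i m → Palindrome (factor i m) → PalindromeAt i m
Palindrome⇒PalindromeAt i m pal x y e = begin
  t (x + i)                    ≡⟨ nth-factor i (subst (suc x ≤_) e (s≤s (m≤m+n x y))) ⟨
  nth (factor i m) x           ≡⟨ cong (λ w → nth w x) pal ⟨
  nth (reverse (factor i m)) x ≡⟨ nth-reverse (factor i m) (trans e (sym (length-factor i m))) ⟩
  nth (factor i m) y           ≡⟨ nth-factor i (subst (suc y ≤_) e (s≤s (m≤n+m y x))) ⟩
  t (y + i)                    ∎
  where open ≡-Reasoning

-- The map φ

φ-tail : Bool → Word → Word
φ-tail a []      = []
φ-tail a (b ∷ w) = a ∷ b ∷ not b ∷ not b ∷ φ-tail b w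

φ : Word → Word
φ []      = []
φ (a ∷ w) = not a ∷ not a ∷ φ-tail a w

dropLast : Word → Word
dropLast []          = []
dropLast (a ∷ [])    = []
dropLast (a ∷ b ∷ w) = a ∷ dropLast (b ∷ w)

trim : Word → Word
trim w = dropLast (drop 1 w)

dropLast-μ² : ∀ a w → dropLast (a ∷ μ (μ w)) ≡ φ-tail a w
dropLast-μ² a []      = refl
dropLast-μ² a (b ∷ w) = cong (λ v → a ∷ b ∷ not b ∷ not b ∷ v)
  (trans (cong (λ c → dropLast (c ∷ μ (μ w))) (not-involutive b)) (dropLast-μ² b w))

φ≡trim-μ² : ∀ w → φ w ≡ trim (μ (μ w))
φ≡trim-μ² []      = refl
φ≡trim-μ² (a ∷ w) = cong (λ v → not a ∷ not a ∷ v)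
  (sym (trans (cong (λ c → dropLast (c ∷ μ (μ w))) (not-involutive a)) (dropLast-μ² a w)))

μ-factor : ∀ i m → μ (factor i m) ≡ factor (i + i) (m + m)
μ-factor i zero = refl
μ-factor i (suc m) rewrite +-suc m m =
  cong₂ _∷_ (sym (t-double i)) (cong₂ _∷_ (sym (t-double-suc i))
    (trans (μ-factor (suc i) m) (cong (λ j → factor (suc j) (m + m)) (+-suc i i))))

dropLast-factor : ∀ i m → dropLast (factor i (suc m)) ≡ factor i m
dropLast-factor i zero    = refl
dropLast-factor i (suc m) = cong (t i ∷_) (dropLast-factor (suc i) m)

φ-factor : ∀ k m → φ (factor k (suc m)) ≡ factor (1 + 4 * k) (2 + 4 * m)
φ-factor k m = begin
  φ (factor k (suc m))
    ≡⟨ φ≡trim-μ² (factor k (suc m)) ⟩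
  trim (μ (μ (factor k (suc m))))
    ≡⟨ cong (λ w → trim (μ w)) (μ-factor k (suc m)) ⟩
  trim (μ (factor (k + k) (suc m + suc m)))
    ≡⟨ cong trim (μ-factor (k + k) (suc m + suc m)) ⟩
  trim (factor ((k + k) + (k + k)) ((suc m + suc m) + (suc m + suc m)))
    ≡⟨ cong₂ (λ i n → trim (factor i n)) 4k 4+4m ⟩
  trim (factor (4 * k) (2 + (2 + 4 * m)))
    ≡⟨ dropLast-factor (1 + 4 * k) (2 + 4 * m) ⟩
  factor (1 + 4 * k) (2 + 4 * m)
    ∎
  where
  open ≡-Reasoning
  4k : (k + k) + (k + k) ≡ 4 * k
  4k = solve (k ∷ [])
  4+4m : (suc m + suc m) + (suc m + suc m) ≡ 2 + (2 + 4 * m)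
  4+4m = solve (m ∷ [])

length-φ-tail : ∀ a w → length (φ-tail a w) ≡ 4 * length w
length-φ-tail a []      = refl
length-φ-tail a (b ∷ w) = trans (cong (4 +_) (length-φ-tail b w)) (sym (*-suc 4 (length w)))

length-φ : ∀ a w → length (φ (a ∷ w)) ≡ 2 + 4 * length w
length-φ a w = cong (2 +_) (length-φ-tail a w)

ψ-tail : Word → Word
ψ-tail (_ ∷ b ∷ _ ∷ _ ∷ w) = b ∷ ψ-tail w
ψ-tail _                   = []

ψ : Word → Word
ψ (_ ∷ a ∷ w) = not a ∷ ψ-tail w
ψ _           = []

ψ-tail-φ-tail : ∀ a w → ψ-tail (φ-tail a w) ≡ w
ψ-tail-φ-tail a []      = refl
ψ-tail-φ-tail a (b ∷ w) = cong (b ∷_) (ψ-tail-φ-tail b w)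

ψ-φ : ∀ w → ψ (φ w) ≡ w
ψ-φ []      = refl
ψ-φ (a ∷ w) = cong₂ _∷_ (not-involutive a) (ψ-tail-φ-tail a w)

φ-injective : ∀ {v w} → φ v ≡ φ w → v ≡ w
φ-injective {v} {w} e = trans (sym (ψ-φ v)) (trans (cong ψ e) (ψ-φ w))

μ²-++ : ∀ xs ys → μ (μ (xs ++ ys)) ≡ μ (μ xs) ++ μ (μ ys)
μ²-++ xs ys = trans (cong μ (μ-++ xs ys)) (μ-++ (μ xs) (μ ys))

μ²-reverse : ∀ w → reverse (μ (μ w)) ≡ μ (μ (reverse w))
μ²-reverse []      = refl
μ²-reverse (a ∷ w) = begin
  reverse (μ (μ (a ∷ [])) ++ μ (μ w))            ≡⟨ reverse-++ (μ (μ (a ∷ []))) (μ (μ w)) ⟩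
  reverse (μ (μ w)) ++ reverse (μ (μ (a ∷ [])))  ≡⟨ cong₂ _++_ (μ²-reverse w) (letter-palindrome a) ⟩
  μ (μ (reverse w)) ++ μ (μ (a ∷ []))            ≡⟨ μ²-++ (reverse w) (a ∷ []) ⟨
  μ (μ (reverse w ++ a ∷ []))                    ≡⟨ cong (λ v → μ (μ v)) (unfold-reverse a w) ⟨
  μ (μ (reverse (a ∷ w)))                        ∎
  where
  open ≡-Reasoning
  letter-palindrome : ∀ a → reverse (μ (μ (a ∷ []))) ≡ μ (μ (a ∷ []))
  letter-palindrome false = refl
  letter-palindrome true  = refl

dropLast-∷ʳ : ∀ w a → dropLast (w ++ a ∷ []) ≡ w
dropLast-∷ʳ []          a = refl
dropLast-∷ʳ (b ∷ [])    a = refl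
dropLast-∷ʳ (b ∷ c ∷ w) a = cong (b ∷_) (dropLast-∷ʳ (c ∷ w) a)

reverse-drop-1 : ∀ w → reverse (drop 1 w) ≡ dropLast (reverse w)
reverse-drop-1 []      = refl
reverse-drop-1 (a ∷ w) = sym (trans (cong dropLast (unfold-reverse a w)) (dropLast-∷ʳ (reverse w) a))

reverse-dropLast : ∀ w → reverse (dropLast w) ≡ drop 1 (reverse w)
reverse-dropLast w = begin
  reverse (dropLast w)                             ≡⟨ cong (λ v → reverse (dropLast v)) (reverse-involutive w) ⟨
  reverse (dropLast (reverse (reverse w)))         ≡⟨ cong reverse (reverse-drop-1 (reverse w)) ⟨
  reverse (reverse (drop 1 (reverse w)))           ≡⟨ reverse-involutive (drop 1 (reverse w)) ⟩
  drop 1 (reverse w)                               ∎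
  where open ≡-Reasoning

drop-1-dropLast : ∀ w → drop 1 (dropLast w) ≡ dropLast (drop 1 w)
drop-1-dropLast []          = refl
drop-1-dropLast (a ∷ [])    = refl
drop-1-dropLast (a ∷ b ∷ w) = refl

reverse-trim : ∀ w → reverse (trim w) ≡ trim (reverse w)
reverse-trim w = begin
  reverse (dropLast (drop 1 w))  ≡⟨ reverse-dropLast (drop 1 w) ⟩
  drop 1 (reverse (drop 1 w))    ≡⟨ cong (drop 1) (reverse-drop-1 w) ⟩
  drop 1 (dropLast (reverse w))  ≡⟨ drop-1-dropLast (reverse w) ⟩
  dropLast (drop 1 (reverse w))  ∎
  where open ≡-Reasoning

φ-reverse : ∀ w → reverse (φ w) ≡ φ (reverse w)
φ-reverse w = begin
  reverse (φ w)                  ≡⟨ cong reverse (φ≡trim-μ² w) ⟩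
  reverse (trim (μ (μ w)))       ≡⟨ reverse-trim (μ (μ w)) ⟩
  trim (reverse (μ (μ w)))       ≡⟨ cong trim (μ²-reverse w) ⟩
  trim (μ (μ (reverse w)))       ≡⟨ φ≡trim-μ² (reverse w) ⟨
  φ (reverse w)                  ∎
  where open ≡-Reasoning

φ-palindrome : ∀ {w} → Palindrome w → Palindrome (φ w)
φ-palindrome {w} pal = trans (φ-reverse w) (cong φ pal)

-- Palindromic factors of length bₙ

palindrome-starts-odd : ∀ g {i} → PalindromeAt i (2 + 4 * (5 + 2 * g)) → ∃ λ j → i ≡ suc (j + j)
palindrome-starts-odd g {i} pal
  with square-at-odd ((10 + 4 * g) + i) (pal (10 + 4 * g) (11 + 4 * g) (solve (g ∷ [])))
... | x , odd with parity i
...   | j , inj₂ i-odd = j , i-odd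
...   | j , inj₁ refl = ⊥-elim (x+x≢1+y+y ((5 + 2 * g) + j) x (trans regroup odd))
  where
  regroup : ((5 + 2 * g) + j) + ((5 + 2 * g) + j) ≡ (10 + 4 * g) + (j + j)
  regroup = solve (g ∷ j ∷ [])

no-palindrome-at-3-mod-4 : ∀ g k → ¬ PalindromeAt (3 + 4 * k) (2 + 4 * (5 + 2 * g))
no-palindrome-at-3-mod-4 g k pal = no-palindrome₅ (k + (1 + g)) outer inner
  where
  open SameLetter
  outer : t (k + (1 + g)) ≡ t (4 + (k + (1 + g)))
  outer = begin
    k + (1 + g)                 ≈⟨ t-4n (k + (1 + g)) ⟨
    4 * (k + (1 + g))           ≡⟨ solve (k ∷ g ∷ []) ⟩
    (1 + 4 * g) + (3 + 4 * k)   ≈⟨ pal (1 + 4 * g) (20 + 4 * g) (solve (g ∷ [])) ⟩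
    (20 + 4 * g) + (3 + 4 * k)  ≡⟨ solve (k ∷ g ∷ []) ⟩
    3 + 4 * (k + (5 + g))       ≈⟨ t-4n+3 (k + (5 + g)) ⟩
    k + (5 + g)                 ≡⟨ solve (k ∷ g ∷ []) ⟩
    4 + (k + (1 + g))           ∎
  inner : t (1 + (k + (1 + g))) ≡ t (3 + (k + (1 + g)))
  inner = begin
    1 + (k + (1 + g))           ≡⟨ solve (k ∷ g ∷ []) ⟩
    k + (2 + g)                 ≈⟨ t-4n (k + (2 + g)) ⟨
    4 * (k + (2 + g))           ≡⟨ solve (k ∷ g ∷ []) ⟩
    (5 + 4 * g) + (3 + 4 * k)   ≈⟨ pal (5 + 4 * g) (16 + 4 * g) (solve (g ∷ [])) ⟩
    (16 + 4 * g) + (3 + 4 * k)  ≡⟨ solve (k ∷ g ∷ []) ⟩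
    3 + 4 * (k + (4 + g))       ≈⟨ t-4n+3 (k + (4 + g)) ⟩
    k + (4 + g)                 ≡⟨ solve (k ∷ g ∷ []) ⟩
    3 + (k + (1 + g))           ∎

palindrome-start : ∀ g {i} → PalindromeAt i (2 + 4 * (5 + 2 * g)) → ∃ λ k → i ≡ 1 + 4 * k
palindrome-start g pal with palindrome-starts-odd g pal
... | j , refl with parity j
...   | k , inj₁ refl = k , solve (k ∷ [])
...   | k , inj₂ refl =
  ⊥-elim (no-palindrome-at-3-mod-4 g k (subst (λ i → PalindromeAt i (2 + 4 * (5 + 2 * g))) 3+4k pal))
  where
  3+4k : suc (suc (k + k) + suc (k + k)) ≡ 3 + 4 * k
  3+4k = solve (k ∷ [])

PalindromeAt-φ⁻-pair : ∀ {k} x y → PalindromeAt (1 + 4 * k) (2 + 4 * (x + suc y)) →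
                       t (x + k) ≡ t (suc y + k)
PalindromeAt-φ⁻-pair {k} x y pal = begin
  x + k                      ≈⟨ t-4n+3 (x + k) ⟨
  3 + 4 * (x + k)            ≡⟨ solve (x ∷ k ∷ []) ⟩
  (2 + 4 * x) + (1 + 4 * k)  ≈⟨ pal (2 + 4 * x) (3 + 4 * y) (solve (x ∷ y ∷ [])) ⟩
  (3 + 4 * y) + (1 + 4 * k)  ≡⟨ solve (y ∷ k ∷ []) ⟩
  4 * (suc y + k)            ≈⟨ t-4n (suc y + k) ⟩
  suc y + k                  ∎
  where open SameLetter

PalindromeAt-φ⁻ : ∀ {k M} → PalindromeAt (1 + 4 * k) (2 + 4 * M) → PalindromeAt k (suc M)
PalindromeAt-φ⁻ pal x       (suc y) refl = PalindromeAt-φ⁻-pair x y pal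
PalindromeAt-φ⁻ pal zero    zero    refl = refl
PalindromeAt-φ⁻ {k} pal (suc x) zero refl =
  sym (PalindromeAt-φ⁻-pair 0 x (subst (λ n → PalindromeAt (1 + 4 * k) (2 + 4 * n)) (+-identityʳ (suc x)) pal))

palindrome-desubstitution : ∀ g {i} → PalindromeAt i (2 + 4 * (5 + 2 * g)) →
                            ∃ λ k → i ≡ 1 + 4 * k × PalindromeAt k (6 + 2 * g)
palindrome-desubstitution g pal with palindrome-start g pal
... | k , refl = k , refl , PalindromeAt-φ⁻ {M = 5 + 2 * g} pal

w101101 w010010 w110011 w001100 w0010110100 w1101001011 : Word
w101101     = true ∷ false ∷ true ∷ true ∷ false ∷ true ∷ []
w010010     = false ∷ true ∷ false ∷ false ∷ true ∷ false ∷ []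
w110011     = true ∷ true ∷ false ∷ false ∷ true ∷ true ∷ []
w001100     = false ∷ false ∷ true ∷ true ∷ false ∷ false ∷ []
w0010110100 = false ∷ false ∷ true ∷ false ∷ true ∷ true ∷ false ∷ true ∷ false ∷ false ∷ []
w1101001011 = true ∷ true ∷ false ∷ true ∷ false ∷ false ∷ true ∷ false ∷ true ∷ true ∷ []

six-palindromes : List Word
six-palindromes = w101101 ∷ w010010 ∷ w110011 ∷ w001100 ∷ []

six-palindromes-unique : Unique six-palindromes
six-palindromes-unique =
  ((λ ()) All.∷ (λ ()) All.∷ (λ ()) All.∷ All.[]) AllPairs.∷
  ((λ ()) All.∷ (λ ()) All.∷ All.[]) AllPairs.∷
  ((λ ()) All.∷ All.[]) AllPairs.∷
  All.[] AllPairs.∷ AllPairs.[]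

palindrome-shape : Bool → Bool → Word
palindrome-shape c d = c ∷ d ∷ not d ∷ not d ∷ d ∷ c ∷ []

palindrome-shape-∈ : ∀ c d → palindrome-shape c d ∈ six-palindromes
palindrome-shape-∈ true  false = here refl
palindrome-shape-∈ false true  = there (here refl)
palindrome-shape-∈ true  true  = there (there (here refl))
palindrome-shape-∈ false false = there (there (there (here refl)))

palindromic-factor-6-∈ : ∀ {i} → PalindromeAt i 6 → factor i 6 ∈ six-palindromes
palindromic-factor-6-∈ {i} pal with square-at-odd (2 + i) (pal 2 3 refl)
... | x , odd with parity i
...   | j , inj₁ refl = ⊥-elim (x+x≢1+y+y (suc j) x (trans (cong suc (+-suc j j)) odd))
...   | j , inj₂ refl = subst (_∈ six-palindromes) (sym shape) (palindrome-shape-∈ (not (t j)) (t (suc j)))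
  where
  letter₀ : t (suc (j + j)) ≡ not (t j)
  letter₀ = t-double-suc j
  letter₁ : t (2 + (j + j)) ≡ t (suc j)
  letter₁ = t-double-at (2 + (j + j)) (suc j) (cong suc (sym (+-suc j j)))
  letter₂ : t (3 + (j + j)) ≡ not (t (suc j))
  letter₂ = t-double-suc-at (3 + (j + j)) (suc j) (cong (λ n → suc (suc n)) (sym (+-suc j j)))
  shape : factor (suc (j + j)) 6 ≡ palindrome-shape (not (t j)) (t (suc j))
  shape = cong₂ _∷_ letter₀ (cong₂ _∷_ letter₁ (cong₂ _∷_ letter₂
    (cong₂ _∷_ (trans (sym (pal 2 3 refl)) letter₂) (cong₂ _∷_ (trans (sym (pal 1 4 refl)) letter₁)
    (cong₂ _∷_ (trans (sym (pal 0 5 refl)) letter₀) refl)))))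

2+4[5+2g]≡6+2[8+4g] : ∀ g → 2 + 4 * (5 + 2 * g) ≡ 6 + 2 * (8 + 4 * g)
2+4[5+2g]≡6+2[8+4g] g = solve (g ∷ [])

b-shape : ∀ n → ∃ λ g → b (suc n) ≡ 6 + 2 * g × b (suc (suc n)) ≡ 2 + 4 * (5 + 2 * g)
b-shape zero = 0 , refl , refl
b-shape (suc n) with b-shape n
... | g , _ , b′≡ =
  8 + 4 * g , trans b′≡ (2+4[5+2g]≡6+2[8+4g] g) , trans (cong (λ m → 4 * m ∸ 2) b′≡) (cong (_∸ 2) quadruple)
  where
  quadruple : 4 * (2 + 4 * (5 + 2 * g)) ≡ 2 + (2 + 4 * (5 + 2 * (8 + 4 * g)))
  quadruple = solve (g ∷ [])

φ^ : ℕ → Word → Word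
φ^ zero    w = w
φ^ (suc n) w = φ (φ^ n w)

φ^-φ : ∀ n w → φ^ n (φ w) ≡ φ (φ^ n w)
φ^-φ zero    w = refl
φ^-φ (suc n) w = cong φ (φ^-φ n w)

φ^-injective : ∀ n {v w} → φ^ n v ≡ φ^ n w → v ≡ w
φ^-injective zero    e = e
φ^-injective (suc n) e = φ^-injective n (φ-injective e)

φ^-palindrome : ∀ n {w} → Palindrome w → Palindrome (φ^ n w)
φ^-palindrome zero    pal = pal
φ^-palindrome (suc n) pal = φ-palindrome (φ^-palindrome n pal)

φ^-factor : ∀ n {w i} → w ≡ factor i 6 → ∃ λ j → φ^ n w ≡ factor j (b (suc n))
φ^-factor zero    {i = i} e = i , e
φ^-factor (suc n) {w} {i} e with φ^-factor n {i = i} e | b-shape n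
... | j , e′ | g , b≡ , b′≡ = 1 + 4 * j , (begin
  φ (φ^ n w)                           ≡⟨ cong φ (trans e′ (cong (factor j) b≡)) ⟩
  φ (factor j (6 + 2 * g))             ≡⟨ φ-factor j (5 + 2 * g) ⟩
  factor (1 + 4 * j) (2 + 4 * (5 + 2 * g)) ≡⟨ cong (factor (1 + 4 * j)) b′≡ ⟨
  factor (1 + 4 * j) (b (suc (suc n))) ∎)
  where open ≡-Reasoning

palindromes : ℕ → List Word
palindromes n = map (φ^ n) six-palindromes

palindromic-factor-∈ : ∀ n {i} → PalindromeAt i (b (suc n)) → factor i (b (suc n)) ∈ palindromes n
palindromic-factor-∈ zero    pal = palindromic-factor-6-∈ pal
palindromic-factor-∈ (suc n) {i} pal with b-shape n
... | g , b≡ , b′≡ with palindrome-desubstitution g (subst (PalindromeAt i) b′≡ pal)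
...   | k , refl , palk = subst (λ m → factor (1 + 4 * k) m ∈ palindromes (suc n)) (sym b′≡) image
  where
  preimage : factor k (6 + 2 * g) ∈ palindromes n
  preimage = subst (λ m → factor k m ∈ palindromes n) b≡
    (palindromic-factor-∈ n (subst (PalindromeAt k) (sym b≡) palk))
  image : factor (1 + 4 * k) (2 + 4 * (5 + 2 * g)) ∈ palindromes (suc n)
  image = subst (_∈ palindromes (suc n)) (φ-factor k (5 + 2 * g)) (∈-map⁺ φ preimage)

-- Complete first returns

Occurs : Word → Word → ℕ → Set
Occurs v w p = isPrefixB v (drop p w) ≡ true

isPrefixB-++ : ∀ v s → isPrefixB v (v ++ s) ≡ true
isPrefixB-++ []      s = refl
isPrefixB-++ (a ∷ v) s with a ≟B a
... | yes _   = isPrefixB-++ v s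
... | no  a≢a = ⊥-elim (a≢a refl)

isPrefixB-sound : ∀ v w → isPrefixB v w ≡ true → ∃ λ s → v ++ s ≡ w
isPrefixB-sound []      w       _ = w , refl
isPrefixB-sound (a ∷ v) (b ∷ w) e with a ≟B b
isPrefixB-sound (a ∷ v) (b ∷ w) e  | yes refl with isPrefixB-sound v w e
... | s , e′ = s , cong (a ∷_) e′
isPrefixB-sound (a ∷ v) (b ∷ w) () | no _

isPrefixB-factor : ∀ v j o → isPrefixB v (factor j o) ≡ true →
                   ∃ λ r → length v + r ≡ o × v ≡ factor j (length v)
isPrefixB-factor []      j o       _ = o , refl , refl
isPrefixB-factor (a ∷ v) j (suc o) e with a ≟B t j
isPrefixB-factor (a ∷ v) j (suc o) e  | yes refl with isPrefixB-factor v (suc j) o e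
... | r , fits , v≡ = r , cong suc fits , cong (t j ∷_) v≡
isPrefixB-factor (a ∷ v) j (suc o) () | no _

Occurs-factor⁺ : ∀ {v k} q r → v ≡ factor (q + k) (length v) → Occurs v (factor k (q + (length v + r))) q
Occurs-factor⁺ {v} {k} q r v≡ = subst (λ w → isPrefixB v w ≡ true) (sym window) (isPrefixB-++ v _)
  where
  open ≡-Reasoning
  window : drop q (factor k (q + (length v + r))) ≡ v ++ factor (length v + (q + k)) r
  window = begin
    drop q (factor k (q + (length v + r)))                     ≡⟨ drop-factor q k _ ⟩
    factor (q + k) (q + (length v + r) ∸ q)                    ≡⟨ cong (factor (q + k)) (m+n∸m≡n q _) ⟩
    factor (q + k) (length v + r)                              ≡⟨ factor-++ (q + k) (length v) r ⟩
    factor (q + k) (length v) ++ factor (length v + (q + k)) r ≡⟨ cong (_++ factor (length v + (q + k)) r) v≡ ⟨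
    v ++ factor (length v + (q + k)) r                         ∎

Occurs-factor⁻ : ∀ {v k L} q → v ≢ [] → Occurs v (factor k L) q →
                 ∃ λ r → q + (length v + r) ≡ L × v ≡ factor (q + k) (length v)
Occurs-factor⁻ {[]} q v≢[] _ = ⊥-elim (v≢[] refl)
Occurs-factor⁻ {a ∷ v} {k} {L} q _ occ
  with isPrefixB-factor (a ∷ v) (q + k) (L ∸ q)
         (subst (λ w → isPrefixB (a ∷ v) w ≡ true) (drop-factor q k L) occ)
... | r , fits , v≡ = r , trans (cong (q +_) fits) (m+[n∸m]≡n q≤L) , v≡
  where
  q≤L : q ≤ L
  q≤L with q ≤? L
  ... | yes q≤L = q≤L
  ... | no  q≰L = ⊥-elim (0≢1+n (sym (trans fits (m≤n⇒m∸n≡0 (<⇒≤ (≰⇒> q≰L))))))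

occ-≡0 : ∀ v w → (∀ p → ¬ Occurs v w p) → occ v w ≡ 0
occ-≡0 v []      none rewrite ¬-not (none 0) = refl
occ-≡0 v (x ∷ w) none rewrite ¬-not (none 0) = occ-≡0 v w (λ p → none (suc p))

occ-≡1 : ∀ v w e → Occurs v w e → (∀ p → Occurs v w p → p ≡ e) → occ v w ≡ 1
occ-≡1 v []      zero    hit only rewrite hit = refl
occ-≡1 v (x ∷ w) zero    hit only rewrite hit =
  cong suc (occ-≡0 v w (λ p o → 0≢1+n (sym (only (suc p) o))))
occ-≡1 v []      (suc e) hit only = ⊥-elim (0≢1+n (only 0 hit))
occ-≡1 v (x ∷ w) (suc e) hit only rewrite ¬-not (λ o → 0≢1+n (only 0 o)) =
  occ-≡1 v w e hit (λ p o → suc-injective (only (suc p) o))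

occ-≡2 : ∀ v w d → v ≢ [] → 0 < d → Occurs v w 0 → Occurs v w d →
         (∀ p → Occurs v w p → p ≡ 0 ⊎ p ≡ d) → occ v w ≡ 2
occ-≡2 []      w       d       v≢[] _ _   _   _    = ⊥-elim (v≢[] refl)
occ-≡2 (a ∷ v) (x ∷ w) (suc d) _    _ hit₀ hitd only rewrite hit₀ =
  cong suc (occ-≡1 (a ∷ v) w d hitd (λ p o → shift (only (suc p) o)))
  where
  shift : ∀ {p} → suc p ≡ 0 ⊎ suc p ≡ suc d → p ≡ d
  shift (inj₂ e) = suc-injective e

occ-drop : ∀ v c w → occ v (drop c w) ≤ occ v w
occ-drop v zero    w       = ≤-refl
occ-drop v (suc c) []      = ≤-refl
occ-drop v (suc c) (x ∷ w) = ≤-trans (occ-drop v c w) (m≤n+m _ _)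

occ-drop-≤ : ∀ v w {p q} → p ≤ q → occ v (drop q w) ≤ occ v (drop p w)
occ-drop-≤ v w {p} p≤q with m≤n⇒∃[o]m+o≡n p≤q
... | c , refl = subst (λ u → occ v u ≤ occ v (drop p w)) (drop-drop p c w) (occ-drop v c (drop p w))

occ-at-occurrence : ∀ v w p → v ≢ [] → Occurs v w p → occ v (drop p w) ≡ suc (occ v (drop (suc p) w))
occ-at-occurrence []      w p v≢[] _   = ⊥-elim (v≢[] refl)
occ-at-occurrence (a ∷ v) w p _    hit = trans (at-start (drop p w) hit)
  (cong (λ u → suc (occ (a ∷ v) u)) (trans (drop-drop p 1 w) (cong (λ n → drop n w) (+-comm p 1))))
  where
  at-start : ∀ u → isPrefixB (a ∷ v) u ≡ true → occ (a ∷ v) u ≡ suc (occ (a ∷ v) (drop 1 u))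
  at-start []      ()
  at-start (x ∷ u) e rewrite e = refl

occurrence-adds-one : ∀ v w {p q} → v ≢ [] → Occurs v w p → p < q →
                      suc (occ v (drop q w)) ≤ occ v (drop p w)
occurrence-adds-one v w {p} {q} v≢[] hit p<q =
  subst (suc (occ v (drop q w)) ≤_) (sym (occ-at-occurrence v w p v≢[] hit)) (s≤s (occ-drop-≤ v w p<q))

three-occurrences : ∀ v w {a b c} → v ≢ [] → a < b → b < c →
                    Occurs v w a → Occurs v w b → Occurs v w c → 3 ≤ occ v w
three-occurrences v w {a} {b} {c} v≢[] a<b b<c hit-a hit-b hit-c = begin
  3                               ≤⟨ s≤s (s≤s (≤-trans (s≤s z≤n) (occurrence-adds-one v w v≢[] hit-c (n<1+n c)))) ⟩
  suc (suc (occ v (drop c w)))    ≤⟨ s≤s (occurrence-adds-one v w v≢[] hit-b b<c) ⟩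
  suc (occ v (drop b w))          ≤⟨ occurrence-adds-one v w v≢[] hit-a a<b ⟩
  occ v (drop a w)                ≤⟨ occ-drop v a w ⟩
  occ v w                         ∎
  where open ≤-Reasoning

occ≡2⇒only : ∀ v w {d} → v ≢ [] → occ v w ≡ 2 → 0 < d → Occurs v w 0 → Occurs v w d →
             ∀ p → Occurs v w p → p ≡ 0 ⊎ p ≡ d
occ≡2⇒only v w v≢[] two 0<d hit₀ hitd zero    _   = inj₁ refl
occ≡2⇒only v w {d} v≢[] two 0<d hit₀ hitd (suc p) hit with <-cmp (suc p) d
... | tri≈ _ e _ = inj₂ e
... | tri< p<d _ _ = ⊥-elim (<-irrefl refl (subst (3 ≤_) two
                       (three-occurrences v w v≢[] (s≤s z≤n) p<d hit₀ hit hitd)))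
... | tri> _ _ d<p = ⊥-elim (<-irrefl refl (subst (3 ≤_) two
                       (three-occurrences v w v≢[] 0<d d<p hit₀ hitd hit)))

-- u is a complete first return to v exactly when v occurs in u at the positions 0 and
-- |u| − |v| and nowhere else.
record Return (v u : Word) : Set where
  field
    gap      : ℕ
    0<gap    : 0 < gap
    length≡  : gap + length v ≡ length u
    nonempty : v ≢ []
    starts   : Occurs v u 0
    ends     : Occurs v u gap
    only     : ∀ p → Occurs v u p → p ≡ 0 ⊎ p ≡ gap

return-by-counting : ∀ {v u} d → v ≢ [] → 0 < d → d + length v ≡ length u →
                     Occurs v u 0 → Occurs v u d → occ v u ≡ 2 → Return v u
return-by-counting {v} {u} d v≢[] 0<d len hit₀ hitd two = record
  { gap = d ; 0<gap = 0<d ; length≡ = len ; nonempty = v≢[] ; starts = hit₀ ; ends = hitd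
  ; only = occ≡2⇒only v u v≢[] two 0<d hit₀ hitd }

Return⇒CompleteFirstReturn : ∀ {v u} → Return v u → CompleteFirstReturn v u
Return⇒CompleteFirstReturn {v} {u} r =
  isPrefixB-sound v u starts ,
  (take gap u , trans (cong (take gap u ++_) v≡drop) (take++drop≡id gap u)) ,
  occ-≡2 v u gap nonempty 0<gap starts ends only
  where
  open Return r
  length-drop≡ : length (drop gap u) ≡ length v
  length-drop≡ = trans (length-drop gap u) (trans (cong (_∸ gap) (sym length≡)) (m+n∸m≡n gap (length v)))
  v≡drop : v ≡ drop gap u
  v≡drop with isPrefixB-sound v (drop gap u) ends
  ... | []    , e = trans (sym (++-identityʳ v)) e
  ... | x ∷ s , e =
    ⊥-elim (m+1+n≢m (length v) (trans (sym (length-++ v)) (trans (cong length e) length-drop≡)))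

Return-privileged : ∀ {v u} → Privileged v → Return v u → Privileged u
Return-privileged {v} pv r = priv-return (subst (length v <_) length≡ (+-monoˡ-< (length v) 0<gap)) pv
  (Return⇒CompleteFirstReturn r)
  where open Return r

quadruple-window : ∀ q m r M → q + (suc m + r) ≡ suc M → 4 * q + ((2 + 4 * m) + 4 * r) ≡ 2 + 4 * M
quadruple-window q m r M fits = +-cancelˡ-≡ 2 _ _ (begin
  2 + (4 * q + ((2 + 4 * m) + 4 * r)) ≡⟨ solve (q ∷ m ∷ r ∷ []) ⟩
  4 * (q + (suc m + r))               ≡⟨ cong (4 *_) fits ⟩
  4 * suc M                           ≡⟨ solve (M ∷ []) ⟩
  2 + (2 + 4 * M)                     ∎)
  where open ≡-Reasoning

quadruple-gap : ∀ d m n → d + suc m ≡ suc n → 4 * d + (2 + 4 * m) ≡ 2 + 4 * n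
quadruple-gap d m n fits = +-cancelˡ-≡ 2 _ _ (begin
  2 + (4 * d + (2 + 4 * m)) ≡⟨ solve (d ∷ m ∷ []) ⟩
  4 * (d + suc m)           ≡⟨ cong (4 *_) fits ⟩
  4 * suc n                 ≡⟨ solve (n ∷ []) ⟩
  2 + (2 + 4 * n)           ∎)
  where open ≡-Reasoning

4*-split : ∀ a n c → 4 * a + n ≡ 4 * c → ∃ λ d → n ≡ 4 * d × c ≡ d + a
4*-split a n c e = c ∸ a , n≡ , sym (m∸n+n≡m a≤c)
  where
  a≤c : a ≤ c
  a≤c = *-cancelˡ-≤ 4 (subst (4 * a ≤_) e (m≤m+n (4 * a) n))
  n≡ : n ≡ 4 * (c ∸ a)
  n≡ = +-cancelˡ-≡ (4 * a) n (4 * (c ∸ a))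
    (trans e (trans (cong (4 *_) (sym (m+[n∸m]≡n a≤c))) (*-distribˡ-+ 4 a (c ∸ a))))

window-arithmetic : ∀ {k p m M r k′} → p + (1 + 4 * k) ≡ 1 + 4 * k′ → p + ((2 + 4 * m) + r) ≡ 2 + 4 * M →
                    ∃ λ q → p ≡ 4 * q × k′ ≡ q + k × ∃ λ r′ → q + (suc m + r′) ≡ suc M
window-arithmetic {k} {p} {m} {M} {r} {k′} start fits with 4*-split k p k′ (suc-injective (trans shift start))
  where
  shift : 1 + (4 * k + p) ≡ p + (1 + 4 * k)
  shift = solve (k ∷ p ∷ [])
... | q , refl , refl with 4*-split (q + m) r M (+-cancelˡ-≡ 2 _ _ (trans regroup fits))
  where
  regroup : 2 + (4 * (q + m) + r) ≡ 4 * q + ((2 + 4 * m) + r)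
  regroup = solve (q ∷ m ∷ r ∷ [])
...   | r′ , refl , refl = q , refl , refl , r′ , solve (q ∷ m ∷ r′ ∷ [])

Occurs-φ : ∀ {v k M} q → v ≢ [] → Occurs v (factor k (suc M)) q →
           Occurs (φ v) (φ (factor k (suc M))) (4 * q)
Occurs-φ {[]}    q v≢[] _ = ⊥-elim (v≢[] refl)
Occurs-φ {a ∷ v} {k} {M} q _ occ with Occurs-factor⁻ q (λ ()) occ
... | r , fits , v≡ = subst (λ u → Occurs (φ (a ∷ v)) u (4 * q)) (sym (φ-factor k M))
      (subst (λ L → Occurs (φ (a ∷ v)) (factor (1 + 4 * k) L) (4 * q)) lengths
        (Occurs-factor⁺ (4 * q) (4 * r) φv≡))
  where
  open ≡-Reasoning
  shift : 1 + 4 * (q + k) ≡ 4 * q + (1 + 4 * k)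
  shift = solve (q ∷ k ∷ [])
  φv≡ : φ (a ∷ v) ≡ factor (4 * q + (1 + 4 * k)) (length (φ (a ∷ v)))
  φv≡ = begin
    φ (a ∷ v)                                         ≡⟨ cong φ v≡ ⟩
    φ (factor (q + k) (suc (length v)))               ≡⟨ φ-factor (q + k) (length v) ⟩
    factor (1 + 4 * (q + k)) (2 + 4 * length v)       ≡⟨ cong₂ factor shift (sym (length-φ a v)) ⟩
    factor (4 * q + (1 + 4 * k)) (length (φ (a ∷ v))) ∎
  lengths : 4 * q + (length (φ (a ∷ v)) + 4 * r) ≡ 2 + 4 * M
  lengths = trans (cong (λ n → 4 * q + (n + 4 * r)) (length-φ a v)) (quadruple-window q (length v) r M fits)

φ-factor⁻ : ∀ {g v j} → Palindrome v → length v ≡ 6 + 2 * g → φ v ≡ factor j (length (φ v)) →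
            ∃ λ k → j ≡ 1 + 4 * k × v ≡ factor k (length v)
φ-factor⁻ {g} {[]} _ () _
φ-factor⁻ {g} {a ∷ w} {j} pal len φv≡ = preimage (palindrome-start g window)
  where
  window : PalindromeAt j (2 + 4 * (5 + 2 * g))
  window = Palindrome⇒PalindromeAt j _ (subst Palindrome
    (trans φv≡ (cong (factor j) (trans (length-φ a w) (cong (λ n → 2 + 4 * n) (suc-injective len)))))
    (φ-palindrome pal))
  preimage : (∃ λ k → j ≡ 1 + 4 * k) → ∃ λ k → j ≡ 1 + 4 * k × a ∷ w ≡ factor k (length (a ∷ w))
  preimage (k , j≡) = k , j≡ ,
    φ-injective (trans φv≡ (trans (cong₂ factor j≡ (length-φ a w)) (sym (φ-factor k (length w)))))

Occurs-φ⁻ : ∀ {g v k M} p → Palindrome v → length v ≡ 6 + 2 * g → Occurs (φ v) (φ (factor k (suc M))) p →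
            ∃ λ q → p ≡ 4 * q × Occurs v (factor k (suc M)) q
Occurs-φ⁻ {g} {[]} p _ () _
Occurs-φ⁻ {g} {a ∷ w} {k} {M} p pal len occ =
  let r , fits , φv≡ = Occurs-factor⁻ p (λ ()) (subst (λ u → Occurs (φ (a ∷ w)) u p) (φ-factor k M) occ)
      k′ , start , v≡ = φ-factor⁻ {g = g} pal len φv≡
      q , p≡4q , k′≡q+k , r′ , fits′ = window-arithmetic {k} {p} {length w} {M} {r} start
                                          (trans (cong (λ n → p + (n + r)) (sym (length-φ a w))) fits)
  in q , p≡4q , subst (λ L → Occurs (a ∷ w) (factor k L) q) fits′
                  (Occurs-factor⁺ {k = k} q r′ (subst (λ j → a ∷ w ≡ factor j (length (a ∷ w))) k′≡q+k v≡))

length-φ-gap : ∀ {v u} d → v ≢ [] → d + length v ≡ length u → 4 * d + length (φ v) ≡ length (φ u)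
length-φ-gap {[]}    d v≢[] _ = ⊥-elim (v≢[] refl)
length-φ-gap {a ∷ v} {[]}    d _ e = ⊥-elim (m+1+n≢0 d e)
length-φ-gap {a ∷ v} {b ∷ u} d _ e = begin
  4 * d + length (φ (a ∷ v)) ≡⟨ cong (4 * d +_) (length-φ a v) ⟩
  4 * d + (2 + 4 * length v) ≡⟨ quadruple-gap d (length v) (length u) e ⟩
  2 + 4 * length u           ≡⟨ length-φ b u ⟨
  length (φ (b ∷ u))         ∎
  where open ≡-Reasoning

length-φ-6+2g : ∀ {g v} → length v ≡ 6 + 2 * g → length (φ v) ≡ 6 + 2 * (8 + 4 * g)
length-φ-6+2g {g} {a ∷ w} len =
  trans (length-φ a w) (trans (cong (λ n → 2 + 4 * n) (suc-injective len)) (2+4[5+2g]≡6+2[8+4g] g))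

φ-Return : ∀ {g k M v u} → Palindrome v → length v ≡ 6 + 2 * g → u ≡ factor k (suc M) →
           Return v u → Return (φ v) (φ u)
φ-Return {g} {k} {M} {v} pal len refl r = record
  { gap      = 4 * gap
  ; 0<gap    = *-monoʳ-< 4 0<gap
  ; length≡  = length-φ-gap {v} {factor k (suc M)} gap nonempty length≡
  ; nonempty = φ-nonempty nonempty
  ; starts   = Occurs-φ 0 nonempty starts
  ; ends     = Occurs-φ gap nonempty ends
  ; only     = only′
  }
  where
  open Return r
  φ-nonempty : ∀ {w} → w ≢ [] → φ w ≢ []
  φ-nonempty {[]}    w≢[] = ⊥-elim (w≢[] refl)
  φ-nonempty {_ ∷ _} _    = λ ()
  only′ : ∀ p → Occurs (φ v) (φ (factor k (suc M))) p → p ≡ 0 ⊎ p ≡ 4 * gap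
  only′ p occ with Occurs-φ⁻ {g} p pal len occ
  ... | q , refl , occ′ with only q occ′
  ...   | inj₁ q≡0   = inj₁ (cong (4 *_) q≡0)
  ...   | inj₂ q≡gap = inj₂ (cong (4 *_) q≡gap)

φ^-Return : ∀ n {g k M v u} → Palindrome v → length v ≡ 6 + 2 * g → u ≡ factor k (suc M) →
            Return v u → Return (φ^ n v) (φ^ n u)
φ^-Return zero    _   _   _  r = r
φ^-Return (suc n) {g} {k} {M} {v} {u} pal len u≡ r = subst₂ Return (φ^-φ n v) (φ^-φ n u)
  (φ^-Return n {8 + 4 * g} {1 + 4 * k} {1 + 4 * M} (φ-palindrome pal) (length-φ-6+2g {g} {v} len)
    (trans (cong φ u≡) (φ-factor k M)) (φ-Return {g} {k} {M} pal len u≡ r))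

iterated-return : ∀ n g k M {v w} → Palindrome v → length v ≡ 6 + 2 * g → w ≡ factor k (suc M) →
                  Return v (φ w) → Return (φ^ n v) (φ^ (suc n) w)
iterated-return n g k M {v} {w} pal len w≡ r = subst (Return (φ^ n v)) (φ^-φ n w)
  (φ^-Return n {g} {1 + 4 * k} {1 + 4 * M} pal len (trans (cong φ w≡) (φ-factor k M)) r)

-- Privileged palindromic factors

privileged-00 : Privileged (false ∷ false ∷ [])
privileged-00 = Return-privileged (priv-letter false) (return-by-counting 1 (λ ()) (s≤s z≤n) refl refl refl refl)

privileged-11 : Privileged (true ∷ true ∷ [])
privileged-11 = Return-privileged (priv-letter true) (return-by-counting 1 (λ ()) (s≤s z≤n) refl refl refl refl)

privileged-010 : Privileged (false ∷ true ∷ false ∷ [])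
privileged-010 = Return-privileged (priv-letter false) (return-by-counting 2 (λ ()) (s≤s z≤n) refl refl refl refl)

privileged-101 : Privileged (true ∷ false ∷ true ∷ [])
privileged-101 = Return-privileged (priv-letter true) (return-by-counting 2 (λ ()) (s≤s z≤n) refl refl refl refl)

return-0010110100-φ101101 : Return w0010110100 (φ w101101)
return-0010110100-φ101101 = return-by-counting 12 (λ ()) (s≤s z≤n) refl refl refl refl

return-1101001011-φ010010 : Return w1101001011 (φ w010010)
return-1101001011-φ010010 = return-by-counting 12 (λ ()) (s≤s z≤n) refl refl refl refl

return-001100-φ110011 : Return w001100 (φ w110011)
return-001100-φ110011 = return-by-counting 16 (λ ()) (s≤s z≤n) refl refl refl refl

return-110011-φ001100 : Return w110011 (φ w001100)
return-110011-φ001100 = return-by-counting 16 (λ ()) (s≤s z≤n) refl refl refl refl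

return-110011-φ0010110100 : Return w110011 (φ w0010110100)
return-110011-φ0010110100 = return-by-counting 32 (λ ()) (s≤s z≤n) refl refl refl refl

return-001100-φ1101001011 : Return w001100 (φ w1101001011)
return-001100-φ1101001011 = return-by-counting 32 (λ ()) (s≤s z≤n) refl refl refl refl

privileged-φ^ : ∀ n → Privileged (φ^ n w101101) × Privileged (φ^ n w010010) × Privileged (φ^ n w110011) ×
                      Privileged (φ^ n w001100) × Privileged (φ^ n w0010110100) × Privileged (φ^ n w1101001011)
privileged-φ^ zero =
  Return-privileged privileged-101 (return-by-counting 3 (λ ()) (s≤s z≤n) refl refl refl refl) ,
  Return-privileged privileged-010 (return-by-counting 3 (λ ()) (s≤s z≤n) refl refl refl refl) ,
  Return-privileged privileged-11  (return-by-counting 4 (λ ()) (s≤s z≤n) refl refl refl refl) ,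
  Return-privileged privileged-00  (return-by-counting 4 (λ ()) (s≤s z≤n) refl refl refl refl) ,
  Return-privileged privileged-00  (return-by-counting 8 (λ ()) (s≤s z≤n) refl refl refl refl) ,
  Return-privileged privileged-11  (return-by-counting 8 (λ ()) (s≤s z≤n) refl refl refl refl)
privileged-φ^ (suc n) with privileged-φ^ n
... | _ , _ , C , D , W , W′ =
  Return-privileged W  (iterated-return n 2 11 5 refl refl refl return-0010110100-φ101101) ,
  Return-privileged W′ (iterated-return n 2 15 5 refl refl refl return-1101001011-φ010010) ,
  Return-privileged D  (iterated-return n 0 21 5 refl refl refl return-001100-φ110011) ,
  Return-privileged C  (iterated-return n 0 5  5 refl refl refl return-110011-φ001100) ,
  Return-privileged C  (iterated-return n 0 9  9 refl refl refl return-110011-φ0010110100) ,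
  Return-privileged D  (iterated-return n 0 13 9 refl refl refl return-001100-φ1101001011)

PrivilegedPalindromicFactor : ℕ → Word → Set
PrivilegedPalindromicFactor m w = IsFactorOfLength m w × Privileged w × Palindrome w

φ^-privileged-palindromic-factor : ∀ n {w} i → w ≡ factor i 6 → Palindrome w → Privileged (φ^ n w) →
                                   PrivilegedPalindromicFactor (b (suc n)) (φ^ n w)
φ^-privileged-palindromic-factor n i w≡ pal priv =
  let j , φ^w≡ = φ^-factor n {i = i} w≡
  in (j , trans (factorAt≡factor j _) (sym φ^w≡)) , priv , φ^-palindrome n pal

palindromes-sound : ∀ n {w} → w ∈ palindromes n → PrivilegedPalindromicFactor (b (suc n)) w
palindromes-sound n w∈ with privileged-φ^ n | w∈
... | A , _ , _ , _ , _ , _ | here refl                         = φ^-privileged-palindromic-factor n 11 refl refl A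
... | _ , B , _ , _ , _ , _ | there (here refl)                 = φ^-privileged-palindromic-factor n 15 refl refl B
... | _ , _ , C , _ , _ , _ | there (there (here refl))         = φ^-privileged-palindromic-factor n 21 refl refl C
... | _ , _ , _ , D , _ , _ | there (there (there (here refl))) = φ^-privileged-palindromic-factor n 5  refl refl D

palindromes-complete : ∀ n {w} → PrivilegedPalindromicFactor (b (suc n)) w → w ∈ palindromes n
palindromes-complete n ((i , refl) , _ , pal) =
  subst (_∈ palindromes n) (sym (factorAt≡factor i _))
    (palindromic-factor-∈ n (Palindrome⇒PalindromeAt i _ (subst Palindrome (factorAt≡factor i _) pal)))

palindromes-unique : ∀ n → Unique (palindromes n)
palindromes-unique n = map⁺ (φ^-injective n) six-palindromes-unique

lemma5p3 : (n : ℕ) → 1 ≤ n → 𝓑≡ (b n) 4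
lemma5p3 (suc n) _ =
  palindromes n , palindromes-unique n , refl , λ w → mk⇔ (palindromes-sound n) (palindromes-complete n)
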